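{- Let $\Phi$ be a 2CNF formula on $n$ variables, in which every clause is a disjunction of two literals, no clause is repeated, every variable occurs exactly 4 times and exactly once negated (so $\Phi$ has $2n$ clauses). Let $G$ be the complete signed graph constructed from $\Phi$ as described in the context (for any admissible choice of crowns). Then $\mathrm{OPT}_{\Delta}(G)\le 11n+\mathrm{OPT}_{\mathrm{MD\text{ - }2CNF}}(\Phi)$.
   Context: $\mathrm{OPT}_{\mathrm{MD\text{ - }2CNF}}(\Phi)$ is the minimum, over all truth assignments, of the number of clauses of $\Phi$ not satisfied. A complete signed graph has every pair of distinct vertices labeled positive or negative. A bad triangle is a triple of vertices with exactly one negative pair; a bad triangle cover is a set of pairs containing at least one pair from every bad triangle; $\mathrm{OPT}_{\Delta}(G)$ is the minimum size of a bad triangle cover of $G$. Construction of $G$: for each variable $z$ create a hexagram on 12 vertices: inner vertices $a^z_1,\dots,a^z_6$ and crown vertices $z_1,\dots,z_6$, with positive edges $a^z_ia^z_{i+1}$ (indices mod 6, forming a 6-cycle) and $z_ia^z_i$, $z_ia^z_{i+1}$ for $i=1,\dots,6$. The triangle $\{z_i,a^z_i,a^z_{i+1}\}$ is the $i$-th tooth; a crown/tooth is even or odd according to the parity of $i$. For each clause $C_\ell$ create a clause vertex $c_\ell$; for each literal of $C_\ell$ on a variable $z$, add a positive edge from $c_\ell$ to an odd crown of the $z$-hexagram if the literal is negated, and to an even crown if the literal is not negated, choosing crowns so that every crown is adjacent to at most one clause vertex. All other pairs of vertices are negative. -}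

module Defs where

open import Data.Nat using (ℕ; zero; suc; _+_; _⊓_)
open import Data.Fin using (Fin; zero; suc)
open import Data.Bool using (Bool; true; false; not; _∧_; _∨_; if_then_else_)
open import Data.Product using (_×_; _,_; proj₁; proj₂; Σ; ∃)
open import Data.Sum using (_⊎_)
open import Data.List using (List; []; _∷_; map; foldr; _++_)
import Data.List
import Data.Nat
open import Data.Vec using (Vec; []; _∷_; lookup)
open import Data.List.Membership.Propositional using (_∈_)
open import Relation.Binary.PropositionalEquality using (_≡_; _≢_)
open import Relation.Nullary using (¬_)

record Literal (n : ℕ) : Set where
  constructor lit
  field
    var     : Fin n
    negated : Bool
open Literal public

Clause : ℕ → Set
Clause n = Literal n × Literal n

litAt : ∀ {n} → Clause n → Fin 2 → Literal n
litAt c zero    = proj₁ c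
litAt c (suc _) = proj₂ c

Formula : ℕ → ℕ → Set
Formula n m = Fin m → Clause n

SameClause : ∀ {n} → Clause n → Clause n → Set
SameClause (a , b) (c , d) = ((a , b) ≡ (c , d)) ⊎ ((a , b) ≡ (d , c))

NoRepeatedClause : ∀ {n m} → Formula n m → Set
NoRepeatedClause {m = m} Φ = (ℓ ℓ' : Fin m) → SameClause (Φ ℓ) (Φ ℓ') → ℓ ≡ ℓ'

sumF : ∀ {k} → (Fin k → ℕ) → ℕ
sumF {zero}  f = 0
sumF {suc k} f = f zero + sumF (λ i → f (suc i))

countF : ∀ {k} → (Fin k → Bool) → ℕ
countF P = sumF (λ i → if P i then 1 else 0)

_==_ : ∀ {k} → Fin k → Fin k → Bool
zero  == zero  = true
zero  == suc _ = false
suc _ == zero  = false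
suc i == suc j = i == j

occurrences : ∀ {n m} → Formula n m → Fin n → ℕ
occurrences Φ z = sumF (λ ℓ → countF (λ p → var (litAt (Φ ℓ) p) == z))

negOccurrences : ∀ {n m} → Formula n m → Fin n → ℕ
negOccurrences Φ z =
  sumF (λ ℓ → countF (λ p → (var (litAt (Φ ℓ) p) == z) ∧ negated (litAt (Φ ℓ) p)))

Assignment : ℕ → Set
Assignment n = Fin n → Bool

evalLit : ∀ {n} → Assignment n → Literal n → Bool
evalLit α (lit z true)  = not (α z)
evalLit α (lit z false) = α z

evalClause : ∀ {n} → Assignment n → Clause n → Bool
evalClause α (a , b) = evalLit α a ∨ evalLit α b

unsatisfied : ∀ {n m} → Formula n m → Assignment n → ℕ
unsatisfied Φ α = countF (λ ℓ → not (evalClause α (Φ ℓ)))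

allVecs : (n : ℕ) → List (Vec Bool n)
allVecs zero    = [] ∷ []
allVecs (suc n) = map (true ∷_) (allVecs n) ++ map (false ∷_) (allVecs n)

-- OPT_MD-2CNF(Φ): minimum over all truth assignments of the number of
-- unsatisfied clauses.  (The fold starts from m, an upper bound of every
-- value, so this is exactly the minimum over the nonempty list.)
OPT-MD2CNF : ∀ {n m} → Formula n m → ℕ
OPT-MD2CNF {n} {m} Φ = foldr _⊓_ m (map (λ v → unsatisfied Φ (lookup v)) (allVecs n))

suc6 : Fin 6 → Fin 6
suc6 zero                               = suc zero
suc6 (suc zero)                         = suc (suc zero)
suc6 (suc (suc zero))                   = suc (suc (suc zero))
suc6 (suc (suc (suc zero)))             = suc (suc (suc (suc zero)))
suc6 (suc (suc (suc (suc zero))))       = suc (suc (suc (suc (suc zero))))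
suc6 (suc (suc (suc (suc (suc zero))))) = zero

-- Fin 6 index i stands for the paper's index i+1 ∈ {1,…,6}.
-- oddIndex i = true iff the paper index i+1 is odd.
oddIndex : Fin 6 → Bool
oddIndex zero                               = true
oddIndex (suc zero)                         = false
oddIndex (suc (suc zero))                   = true
oddIndex (suc (suc (suc zero)))             = false
oddIndex (suc (suc (suc (suc zero))))       = true
oddIndex (suc (suc (suc (suc (suc zero))))) = false

-- A choice of crowns: literal occurrence (ℓ, p) is joined to crown cr ℓ p
-- of the hexagram of its variable.
CrownChoice : ℕ → Set
CrownChoice m = Fin m → Fin 2 → Fin 6

-- admissibility: negated literals go to odd crowns, non-negated ones to even
-- crowns, and every crown is adjacent to at most one clause vertex
-- (distinct literal occurrences of the same variable use distinct crowns).
Admissible : ∀ {n m} → Formula n m → CrownChoice m → Set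
Admissible {n} {m} Φ cr =
  ((ℓ : Fin m) (p : Fin 2) → oddIndex (cr ℓ p) ≡ negated (litAt (Φ ℓ) p)) ×
  ((ℓ ℓ' : Fin m) (p p' : Fin 2) →
     var (litAt (Φ ℓ) p) ≡ var (litAt (Φ ℓ') p') → cr ℓ p ≡ cr ℓ' p' → ℓ ≡ ℓ')

data Vertex (n m : ℕ) : Set where
  inner  : Fin n → Fin 6 → Vertex n m
  crown  : Fin n → Fin 6 → Vertex n m
  clause : Fin m → Vertex n m

data PosEdge {n m : ℕ} (Φ : Formula n m) (cr : CrownChoice m) : Vertex n m → Vertex n m → Set where
  cycle  : ∀ z i → PosEdge Φ cr (inner z i) (inner z (suc6 i))
  toothˡ : ∀ z i → PosEdge Φ cr (crown z i) (inner z i)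
  toothʳ : ∀ z i → PosEdge Φ cr (crown z i) (inner z (suc6 i))
  clauseEdge : ∀ ℓ p → PosEdge Φ cr (clause ℓ) (crown (var (litAt (Φ ℓ) p)) (cr ℓ p))

Positive : ∀ {n m} → Formula n m → CrownChoice m → Vertex n m → Vertex n m → Set
Positive Φ cr u v = PosEdge Φ cr u v ⊎ PosEdge Φ cr v u

Negative : ∀ {n m} → Formula n m → CrownChoice m → Vertex n m → Vertex n m → Set
Negative Φ cr u v = ¬ Positive Φ cr u v

BadTriangle : ∀ {n m} → Formula n m → CrownChoice m → Vertex n m → Vertex n m → Vertex n m → Set
BadTriangle Φ cr u v w =
  (u ≢ v) × (v ≢ w) × (u ≢ w) ×
  ( (Negative Φ cr u v × Positive Φ cr v w × Positive Φ cr u w)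
  ⊎ (Positive Φ cr u v × Negative Φ cr v w × Positive Φ cr u w)
  ⊎ (Positive Φ cr u v × Positive Φ cr v w × Negative Φ cr u w))

PairSet : ℕ → ℕ → Set
PairSet n m = List (Vertex n m × Vertex n m)

HasPair : ∀ {n m} → PairSet n m → Vertex n m → Vertex n m → Set
HasPair C u v = ((u , v) ∈ C) ⊎ ((v , u) ∈ C)

IsBadTriangleCover : ∀ {n m} → Formula n m → CrownChoice m → PairSet n m → Set
IsBadTriangleCover Φ cr C =
  ∀ u v w → BadTriangle Φ cr u v w → HasPair C u v ⊎ HasPair C v w ⊎ HasPair C u w

-- OPT_Δ(G) ≤ k : there is a bad triangle cover with at most k pairs.
-- (A list of length ≤ k contains at most k distinct pairs, and a set of
-- k pairs can be listed with length k, so this is exactly OPT_Δ(G) ≤ k.)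
OPTΔ≤ : ∀ {n m} → Formula n m → CrownChoice m → ℕ → Set
OPTΔ≤ Φ cr k = Σ (PairSet _ _) λ C → IsBadTriangleCover Φ cr C × (Data.List.length C Data.Nat.≤ k)

{-# OPTIONS --safe #-}
-- View G as a correlation-clustering instance. Fix an assignment α attaining
-- OPT_MD-2CNF. In the hexagram of z keep the three teeth of parity α z as
-- clusters (odd teeth when z is true); a clause vertex joins the crown of its
-- first true literal, which is a singleton crown of the other parity, or stays
-- alone if the clause is false. Every cluster is a positive clique, so the
-- positive pairs it cuts cover every bad triangle: a bad triangle with both
-- positive pairs inside clusters would have its negative pair inside one too.
-- The cut has 9 pairs per hexagram and 1 or 2 per clause according as the
-- clause is satisfied, i.e. 9n + m + OPT_MD-2CNF pairs, and m = 2n.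
module Submission where

open import Defs
open import Data.Nat using (ℕ; zero; suc; _+_; _*_; _≤_; z≤n; s≤s)
open import Data.Nat.Properties
  using ( ≤-reflexive; +-assoc; m≤n⇒m≤1+n; +-monoʳ-≤; *-zeroʳ; *-identityʳ; *-comm; *-assoc
        ; *-distribˡ-+; *-cancelʳ-≡; ⊓-sel; +-commutativeSemigroup; module ≤-Reasoning)
open import Algebra.Properties.CommutativeSemigroup +-commutativeSemigroup using (interchange)
open import Data.Fin using (Fin; zero; suc)
open import Data.Fin.Patterns using (0F; 1F; 2F; 3F; 4F; 5F)
open import Data.Bool using (Bool; true; false; not; _∨_; _xor_; if_then_else_)
open import Data.Bool.Properties using (not-¬)
open import Data.Product using (_×_; _,_; proj₁; proj₂; ∃)
open import Data.Sum using (_⊎_; inj₁; inj₂)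
import Data.Sum as Sum
open import Data.List using (List; []; _∷_; _++_; length; map)
open import Data.List.Properties using (length-++)
open import Data.List.Membership.Propositional using (_∈_)
open import Data.List.Membership.Propositional.Properties
  using (∈-++⁺ˡ; ∈-++⁺ʳ; ∈-map⁻; foldr-selective)
open import Data.List.Relation.Unary.Any using (here; there)
open import Data.Vec using (lookup)
open import Data.Empty using (⊥-elim)
open import Relation.Binary.PropositionalEquality
  using (_≡_; _≢_; refl; sym; trans; cong; cong₂; subst; module ≡-Reasoning)

sumF-cong : ∀ {k} {f g : Fin k → ℕ} → (∀ i → f i ≡ g i) → sumF f ≡ sumF g
sumF-cong {zero}  f≗g = refl
sumF-cong {suc k} f≗g = cong₂ _+_ (f≗g zero) (sumF-cong (λ i → f≗g (suc i)))

sumF-+ : ∀ {k} (f g : Fin k → ℕ) → sumF (λ i → f i + g i) ≡ sumF f + sumF g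
sumF-+ {zero}  f g = refl
sumF-+ {suc k} f g = trans (cong (f zero + g zero +_) (sumF-+ (λ i → f (suc i)) (λ i → g (suc i))))
                           (interchange (f zero) (g zero) _ _)

sumF-const : ∀ {k} c → sumF {k} (λ _ → c) ≡ k * c
sumF-const {zero}  c = refl
sumF-const {suc k} c = cong (c +_) (sumF-const {k} c)

sumF-zero : ∀ {k} → sumF {k} (λ _ → 0) ≡ 0
sumF-zero {k} = trans (sumF-const {k} 0) (*-zeroʳ k)

sumF-swap : ∀ {k l} (f : Fin k → Fin l → ℕ) →
            sumF (λ i → sumF (f i)) ≡ sumF (λ j → sumF (λ i → f i j))
sumF-swap {zero}  {l} f = sym (sumF-zero {l})
sumF-swap {suc k}     f = trans (cong (sumF (f zero) +_) (sumF-swap (λ i → f (suc i))))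
                                (sym (sumF-+ (f zero) (λ j → sumF (λ i → f (suc i) j))))

countF-== : ∀ {k} (v : Fin k) → countF (v ==_) ≡ 1
countF-== {suc k} zero    = cong suc (sumF-zero {k})
countF-== {suc k} (suc v) = countF-== v

countF≤ : ∀ {k} (P : Fin k → Bool) → countF P ≤ k
countF≤ {zero}  P = z≤n
countF≤ {suc k} P with P zero
... | true  = s≤s (countF≤ (λ i → P (suc i)))
... | false = m≤n⇒m≤1+n (countF≤ (λ i → P (suc i)))

concatF : ∀ {k} {A : Set} → (Fin k → List A) → List A
concatF {zero}  f = []
concatF {suc k} f = f zero ++ concatF (λ i → f (suc i))

∈-concatF : ∀ {k} {A : Set} {x : A} (f : Fin k → List A) i → x ∈ f i → x ∈ concatF f
∈-concatF f zero    x∈ = ∈-++⁺ˡ x∈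
∈-concatF f (suc i) x∈ = ∈-++⁺ʳ (f zero) (∈-concatF (λ j → f (suc j)) i x∈)

length-concatF : ∀ {k} {A : Set} (f : Fin k → List A) →
                 length (concatF f) ≡ sumF (λ i → length (f i))
length-concatF {zero}  f = refl
length-concatF {suc k} f = trans (length-++ (f zero))
                                 (cong (length (f zero) +_) (length-concatF (λ i → f (suc i))))

OPT-MD2CNF-attained : ∀ {n m} (Φ : Formula n m) → ∃ λ α → unsatisfied Φ α ≤ OPT-MD2CNF Φ
OPT-MD2CNF-attained {n} {m} Φ
  with foldr-selective ⊓-sel m (map (λ v → unsatisfied Φ (lookup v)) (allVecs n))
... | inj₁ opt≡m = (λ _ → true) , subst (unsatisfied Φ (λ _ → true) ≤_) (sym opt≡m) (countF≤ _)
... | inj₂ opt∈ with ∈-map⁻ _ opt∈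
...   | v , _ , opt≡ = lookup v , ≤-reflexive (sym opt≡)

sumF-occurrences : ∀ {n m} (Φ : Formula n m) → sumF (occurrences Φ) ≡ m * 2
sumF-occurrences {n} {m} Φ = begin
  sumF (λ z → sumF (λ ℓ → countF (λ p → var (L ℓ p) == z)))
    ≡⟨ sumF-swap (λ z ℓ → countF (λ p → var (L ℓ p) == z)) ⟩
  sumF (λ ℓ → sumF (λ z → countF (λ p → var (L ℓ p) == z)))
    ≡⟨ sumF-cong (λ ℓ → sumF-swap (λ z p → if var (L ℓ p) == z then 1 else 0)) ⟩
  sumF (λ ℓ → sumF (λ p → countF (var (L ℓ p) ==_)))
    ≡⟨ sumF-cong (λ ℓ → sumF-cong (λ p → countF-== (var (L ℓ p)))) ⟩
  sumF {m} (λ _ → 2)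
    ≡⟨ sumF-const {m} 2 ⟩
  m * 2 ∎
  where
  open ≡-Reasoning
  L : Fin m → Fin 2 → Literal n
  L ℓ = litAt (Φ ℓ)

clauses≡2*variables : ∀ {n m} (Φ : Formula n m) → ((z : Fin n) → occurrences Φ z ≡ 4) → m ≡ n * 2
clauses≡2*variables {n} {m} Φ occ = *-cancelʳ-≡ m (n * 2) 2 (begin
  m * 2                 ≡⟨ sumF-occurrences Φ ⟨
  sumF (occurrences Φ)  ≡⟨ sumF-cong occ ⟩
  sumF {n} (λ _ → 4)    ≡⟨ sumF-const {n} 4 ⟩
  n * 4                 ≡⟨ *-assoc n 2 2 ⟨
  n * 2 * 2             ∎)
  where open ≡-Reasoning

evalLit-true : ∀ {n} (α : Assignment n) (l : Literal n) → evalLit α l ≡ true → α (var l) ≡ not (negated l)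
evalLit-true α (lit z true) l-true with α z
... | false = refl
evalLit-true α (lit z false) l-true = l-true

crown-injective : ∀ {n m} {z z' : Fin n} {t t' : Fin 6} →
                  crown {n} {m} z t ≡ crown z' t' → z ≡ z' × t ≡ t'
crown-injective refl = refl , refl

crown≢clause : ∀ {n m} {z : Fin n} {t : Fin 6} {ℓ : Fin m} → crown z t ≢ clause ℓ
crown≢clause ()

pred6 : Fin 6 → Fin 6
pred6 0F = 5F
pred6 1F = 0F
pred6 2F = 1F
pred6 3F = 2F
pred6 4F = 3F
pred6 5F = 4F

-- The tooth of parity b containing the inner vertex a_i: tooth i or tooth i - 1.
toothOf : Bool → Fin 6 → Fin 6
toothOf b i = if oddIndex i xor b then pred6 i else i

_∈Tooth_ : Fin 6 → Fin 6 → Set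
i ∈Tooth t = t ≡ i ⊎ suc6 t ≡ i

∈-toothOf : ∀ b i → i ∈Tooth toothOf b i
∈-toothOf true  0F = inj₁ refl
∈-toothOf true  1F = inj₂ refl
∈-toothOf true  2F = inj₁ refl
∈-toothOf true  3F = inj₂ refl
∈-toothOf true  4F = inj₁ refl
∈-toothOf true  5F = inj₂ refl
∈-toothOf false 0F = inj₂ refl
∈-toothOf false 1F = inj₁ refl
∈-toothOf false 2F = inj₂ refl
∈-toothOf false 3F = inj₁ refl
∈-toothOf false 4F = inj₂ refl
∈-toothOf false 5F = inj₁ refl

toothOf-parity : ∀ b i → oddIndex (toothOf b i) ≡ b
toothOf-parity true  0F = refl
toothOf-parity true  1F = refl
toothOf-parity true  2F = refl
toothOf-parity true  3F = refl
toothOf-parity true  4F = refl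
toothOf-parity true  5F = refl
toothOf-parity false 0F = refl
toothOf-parity false 1F = refl
toothOf-parity false 2F = refl
toothOf-parity false 3F = refl
toothOf-parity false 4F = refl
toothOf-parity false 5F = refl

tooth-kept-or-cut : ∀ b i → (toothOf b i ≡ i × toothOf b (suc6 i) ≡ i) ⊎ (oddIndex i xor b ≡ true)
tooth-kept-or-cut true  0F = inj₁ (refl , refl)
tooth-kept-or-cut true  1F = inj₂ refl
tooth-kept-or-cut true  2F = inj₁ (refl , refl)
tooth-kept-or-cut true  3F = inj₂ refl
tooth-kept-or-cut true  4F = inj₁ (refl , refl)
tooth-kept-or-cut true  5F = inj₂ refl
tooth-kept-or-cut false 0F = inj₂ refl
tooth-kept-or-cut false 1F = inj₁ (refl , refl)
tooth-kept-or-cut false 2F = inj₂ refl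
tooth-kept-or-cut false 3F = inj₁ (refl , refl)
tooth-kept-or-cut false 4F = inj₂ refl
tooth-kept-or-cut false 5F = inj₁ (refl , refl)

module _ {n m} {Φ : Formula n m} {cr : CrownChoice m} (z : Fin n) where

  tooth-edge : ∀ {i t} → i ∈Tooth t → PosEdge Φ cr (crown z t) (inner z i)
  tooth-edge (inj₁ refl) = toothˡ z _
  tooth-edge (inj₂ refl) = toothʳ z _

  tooth-clique : ∀ {i j t} → i ∈Tooth t → j ∈Tooth t → i ≢ j → Positive Φ cr (inner z i) (inner z j)
  tooth-clique (inj₁ refl) (inj₁ refl) i≢j = ⊥-elim (i≢j refl)
  tooth-clique (inj₁ refl) (inj₂ refl) i≢j = inj₁ (cycle z _)
  tooth-clique (inj₂ refl) (inj₁ refl) i≢j = inj₂ (cycle z _)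
  tooth-clique (inj₂ refl) (inj₂ refl) i≢j = ⊥-elim (i≢j refl)

toothPairs : ∀ {n m} → Fin n → Fin 6 → PairSet n m
toothPairs z i = (inner z i , inner z (suc6 i)) ∷ (crown z i , inner z i) ∷ (crown z i , inner z (suc6 i)) ∷ []

toothCut : ∀ {n m} → Fin n → Bool → Fin 6 → PairSet n m
toothCut z b i = if oddIndex i xor b then toothPairs z i else []

hexagramCut : ∀ {n m} → Fin n → Bool → PairSet n m
hexagramCut z b = concatF (toothCut z b)

length-hexagramCut : ∀ {n m} (z : Fin n) b → length (hexagramCut {n} {m} z b) ≡ 9
length-hexagramCut z true  = refl
length-hexagramCut z false = refl

∈-hexagramCut : ∀ {n m} {z : Fin n} {b i} {x : Vertex n m × Vertex n m} →
                oddIndex i xor b ≡ true → x ∈ toothPairs z i → x ∈ hexagramCut z b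
∈-hexagramCut {z = z} {b} {i} {x} cut x∈ =
  ∈-concatF (toothCut z b) i (subst (λ c → x ∈ (if c then toothPairs z i else [])) (sym cut) x∈)

module Clustering {n m} {Φ : Formula n m} {cr : CrownChoice m} {A : Set}
  (κ : Vertex n m → A) (C : PairSet n m)
  (clusters-positive : ∀ u v → κ u ≡ κ v → u ≢ v → Positive Φ cr u v)
  (edge-joined-or-cut : ∀ {u v} → PosEdge Φ cr u v → κ u ≡ κ v ⊎ (u , v) ∈ C) where

  joined-or-cut : ∀ {u v} → Positive Φ cr u v → κ u ≡ κ v ⊎ HasPair C u v
  joined-or-cut (inj₁ uv) = Sum.map₂ inj₁ (edge-joined-or-cut uv)
  joined-or-cut (inj₂ vu) = Sum.map sym inj₂ (edge-joined-or-cut vu)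

  cover : IsBadTriangleCover Φ cr C
  cover u v w (u≢v , _ , _ , inj₁ (¬uv , vw , uw)) with joined-or-cut vw | joined-or-cut uw
  ... | inj₂ vw∈ | _        = inj₂ (inj₁ vw∈)
  ... | inj₁ _   | inj₂ uw∈ = inj₂ (inj₂ uw∈)
  ... | inj₁ v~w | inj₁ u~w = ⊥-elim (¬uv (clusters-positive u v (trans u~w (sym v~w)) u≢v))
  cover u v w (_ , v≢w , _ , inj₂ (inj₁ (uv , ¬vw , uw))) with joined-or-cut uv | joined-or-cut uw
  ... | inj₂ uv∈ | _        = inj₁ uv∈
  ... | inj₁ _   | inj₂ uw∈ = inj₂ (inj₂ uw∈)
  ... | inj₁ u~v | inj₁ u~w = ⊥-elim (¬vw (clusters-positive v w (trans (sym u~v) u~w) v≢w))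
  cover u v w (_ , _ , u≢w , inj₂ (inj₂ (uv , vw , ¬uw))) with joined-or-cut uv | joined-or-cut vw
  ... | inj₂ uv∈ | _        = inj₁ uv∈
  ... | inj₁ _   | inj₂ vw∈ = inj₂ (inj₁ vw∈)
  ... | inj₁ u~v | inj₁ v~w = ⊥-elim (¬uw (clusters-positive u w (trans u~v v~w) u≢w))

module AssignmentClustering {n m} (Φ : Formula n m) (cr : CrownChoice m) (adm : Admissible Φ cr)
  (α : Assignment n) where

  ev : Fin m → Fin 2 → Bool
  ev ℓ p = evalLit α (litAt (Φ ℓ) p)

  crownOf : Fin m → Fin 2 → Vertex n m
  crownOf ℓ p = crown (var (litAt (Φ ℓ) p)) (cr ℓ p)

  clauseCluster : Fin m → Bool → Bool → Vertex n m
  clauseCluster ℓ true  _     = crownOf ℓ 0F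
  clauseCluster ℓ false true  = crownOf ℓ 1F
  clauseCluster ℓ false false = clause ℓ

  clauseCut : Fin m → Bool → Bool → PairSet n m
  clauseCut ℓ true  _     = (clause ℓ , crownOf ℓ 1F) ∷ []
  clauseCut ℓ false true  = (clause ℓ , crownOf ℓ 0F) ∷ []
  clauseCut ℓ false false = (clause ℓ , crownOf ℓ 0F) ∷ (clause ℓ , crownOf ℓ 1F) ∷ []

  κ : Vertex n m → Vertex n m
  κ (inner z i) = crown z (toothOf (α z) i)
  κ (crown z t) = crown z t
  κ (clause ℓ)  = clauseCluster ℓ (ev ℓ 0F) (ev ℓ 1F)

  hexagramsCut : PairSet n m
  hexagramsCut = concatF (λ z → hexagramCut z (α z))

  clausesCut : PairSet n m
  clausesCut = concatF (λ ℓ → clauseCut ℓ (ev ℓ 0F) (ev ℓ 1F))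

  cut : PairSet n m
  cut = hexagramsCut ++ clausesCut

  clauseCluster-cases : ∀ ℓ {b₀ b₁} → ev ℓ 0F ≡ b₀ → ev ℓ 1F ≡ b₁ →
    clauseCluster ℓ b₀ b₁ ≡ clause ℓ ⊎ ∃ λ p → clauseCluster ℓ b₀ b₁ ≡ crownOf ℓ p × ev ℓ p ≡ true
  clauseCluster-cases ℓ {true}         ev₀ ev₁ = inj₂ (0F , refl , ev₀)
  clauseCluster-cases ℓ {false} {true}  ev₀ ev₁ = inj₂ (1F , refl , ev₁)
  clauseCluster-cases ℓ {false} {false} ev₀ ev₁ = inj₁ refl

  clause-joined-or-cut : ∀ ℓ p b₀ b₁ →
    clauseCluster ℓ b₀ b₁ ≡ crownOf ℓ p ⊎ (clause ℓ , crownOf ℓ p) ∈ clauseCut ℓ b₀ b₁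
  clause-joined-or-cut ℓ 0F true  _     = inj₁ refl
  clause-joined-or-cut ℓ 0F false true  = inj₂ (here refl)
  clause-joined-or-cut ℓ 0F false false = inj₂ (here refl)
  clause-joined-or-cut ℓ 1F true  _     = inj₂ (here refl)
  clause-joined-or-cut ℓ 1F false true  = inj₁ refl
  clause-joined-or-cut ℓ 1F false false = inj₂ (there (here refl))

  -- A clause vertex only joins the crown of a true literal, whose parity is
  -- opposite to that of the teeth kept for its variable.
  κ-inner≢κ-clause : ∀ z i ℓ → κ (inner z i) ≢ κ (clause ℓ)
  κ-inner≢κ-clause z i ℓ e with clauseCluster-cases ℓ refl refl
  ... | inj₁ alone = crown≢clause (trans e alone)
  ... | inj₂ (p , joined , lit-true) with crown-injective (trans e joined)
  ...   | refl , t≡ = not-¬ parity (evalLit-true α (litAt (Φ ℓ) p) lit-true)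
    where
    open ≡-Reasoning
    parity : α z ≡ negated (litAt (Φ ℓ) p)
    parity = begin
      α z                           ≡⟨ toothOf-parity (α z) i ⟨
      oddIndex (toothOf (α z) i)    ≡⟨ cong oddIndex t≡ ⟩
      oddIndex (cr ℓ p)             ≡⟨ proj₁ adm ℓ p ⟩
      negated (litAt (Φ ℓ) p)       ∎

  clusters-positive : ∀ u v → κ u ≡ κ v → u ≢ v → Positive Φ cr u v
  clusters-positive (inner z i) (inner _ j) e i≢j with crown-injective e
  ... | refl , same = tooth-clique z (∈-toothOf (α z) i)
                        (subst (j ∈Tooth_) (sym same) (∈-toothOf (α z) j)) (λ i≡j → i≢j (cong (inner z) i≡j))
  clusters-positive (inner z i) (crown _ _) e _ with crown-injective e
  ... | refl , refl = inj₂ (tooth-edge z (∈-toothOf (α z) i))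
  clusters-positive (inner z i) (clause ℓ) e _ = ⊥-elim (κ-inner≢κ-clause z i ℓ e)
  clusters-positive (crown z t) (inner z' i) e t≢i =
    Sum.swap (clusters-positive (inner z' i) (crown z t) (sym e) (λ i≡t → t≢i (sym i≡t)))
  clusters-positive (crown z t) (crown z' t') e t≢t' = ⊥-elim (t≢t' e)
  clusters-positive (crown z t) (clause ℓ) e _ with clauseCluster-cases ℓ refl refl
  ... | inj₁ alone = ⊥-elim (crown≢clause (trans e alone))
  ... | inj₂ (p , joined , _) with crown-injective (trans e joined)
  ...   | refl , refl = inj₂ (clauseEdge ℓ p)
  clusters-positive (clause ℓ) (inner z i) e _ = ⊥-elim (κ-inner≢κ-clause z i ℓ (sym e))
  clusters-positive (clause ℓ) (crown z t) e ℓ≢t =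
    Sum.swap (clusters-positive (crown z t) (clause ℓ) (sym e) (λ t≡ℓ → ℓ≢t (sym t≡ℓ)))
  clusters-positive (clause ℓ) (clause ℓ') e ℓ≢ℓ'
    with clauseCluster-cases ℓ refl refl | clauseCluster-cases ℓ' refl refl
  ... | inj₁ alone | inj₁ alone' = ⊥-elim (ℓ≢ℓ' (trans (sym alone) (trans e alone')))
  ... | inj₁ alone | inj₂ (_ , joined' , _) = ⊥-elim (crown≢clause (sym (trans (sym alone) (trans e joined'))))
  ... | inj₂ (_ , joined , _) | inj₁ alone' = ⊥-elim (crown≢clause (trans (sym joined) (trans e alone')))
  ... | inj₂ (p , joined , _) | inj₂ (p' , joined' , _)
    with crown-injective (trans (sym joined) (trans e joined'))
  ...   | same-var , same-crown = ⊥-elim (ℓ≢ℓ' (cong clause (proj₂ adm ℓ ℓ' p p' same-var same-crown)))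

  tooth-joined-or-cut : ∀ z i {x} → x ∈ toothPairs z i →
    (toothOf (α z) i ≡ i × toothOf (α z) (suc6 i) ≡ i) ⊎ x ∈ cut
  tooth-joined-or-cut z i x∈ =
    Sum.map₂ (λ c → ∈-++⁺ˡ (∈-concatF _ z (∈-hexagramCut c x∈))) (tooth-kept-or-cut (α z) i)

  edge-joined-or-cut : ∀ {u v} → PosEdge Φ cr u v → κ u ≡ κ v ⊎ (u , v) ∈ cut
  edge-joined-or-cut (cycle z i) =
    Sum.map₁ (λ kept → cong (crown z) (trans (proj₁ kept) (sym (proj₂ kept))))
             (tooth-joined-or-cut z i (here refl))
  edge-joined-or-cut (toothˡ z i) =
    Sum.map₁ (λ kept → cong (crown z) (sym (proj₁ kept))) (tooth-joined-or-cut z i (there (here refl)))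
  edge-joined-or-cut (toothʳ z i) =
    Sum.map₁ (λ kept → cong (crown z) (sym (proj₂ kept))) (tooth-joined-or-cut z i (there (there (here refl))))
  edge-joined-or-cut (clauseEdge ℓ p) =
    Sum.map₂ (λ x∈ → ∈-++⁺ʳ hexagramsCut (∈-concatF _ ℓ x∈)) (clause-joined-or-cut ℓ p (ev ℓ 0F) (ev ℓ 1F))

  cut-covers : IsBadTriangleCover Φ cr cut
  cut-covers = Clustering.cover κ cut clusters-positive edge-joined-or-cut

  length-clauseCut : ∀ ℓ b₀ b₁ → length (clauseCut ℓ b₀ b₁) ≡ 1 + (if not (b₀ ∨ b₁) then 1 else 0)
  length-clauseCut ℓ true  _     = refl
  length-clauseCut ℓ false true  = refl
  length-clauseCut ℓ false false = refl

  length-cut : length cut ≡ n * 9 + (m + unsatisfied Φ α)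
  length-cut = trans (length-++ hexagramsCut) (cong₂ _+_ hexagrams clauses)
    where
    open ≡-Reasoning
    hexagrams : length hexagramsCut ≡ n * 9
    hexagrams = begin
      length hexagramsCut                                ≡⟨ length-concatF (λ z → hexagramCut z (α z)) ⟩
      sumF (λ z → length (hexagramCut {n} {m} z (α z))) ≡⟨ sumF-cong (λ z → length-hexagramCut z (α z)) ⟩
      sumF {n} (λ _ → 9)                                 ≡⟨ sumF-const {n} 9 ⟩
      n * 9                                              ∎
    falsified : Fin m → ℕ
    falsified ℓ = if not (ev ℓ 0F ∨ ev ℓ 1F) then 1 else 0
    clauses : length clausesCut ≡ m + unsatisfied Φ α
    clauses = begin
      length clausesCut                          ≡⟨ length-concatF (λ ℓ → clauseCut ℓ (ev ℓ 0F) (ev ℓ 1F)) ⟩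
      sumF (λ ℓ → length (clauseCut ℓ (ev ℓ 0F) (ev ℓ 1F)))
                                                 ≡⟨ sumF-cong (λ ℓ → length-clauseCut ℓ (ev ℓ 0F) (ev ℓ 1F)) ⟩
      sumF (λ ℓ → 1 + falsified ℓ)               ≡⟨ sumF-+ (λ _ → 1) falsified ⟩
      sumF {m} (λ _ → 1) + unsatisfied Φ α       ≡⟨ cong (_+ unsatisfied Φ α) (sumF-const {m} 1) ⟩
      m * 1 + unsatisfied Φ α                    ≡⟨ cong (_+ unsatisfied Φ α) (*-identityʳ m) ⟩
      m + unsatisfied Φ α                        ∎

lemma5 : (n m : ℕ) (Φ : Formula n m) →
         NoRepeatedClause Φ →
         ((z : Fin n) → occurrences Φ z ≡ 4) →
         ((z : Fin n) → negOccurrences Φ z ≡ 1) →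
         (cr : CrownChoice m) → Admissible Φ cr →
         OPTΔ≤ Φ cr (11 * n + OPT-MD2CNF Φ)
-- Of the hypotheses on Φ, this bound only needs m = 2n.
lemma5 n m Φ _ occ _ cr adm with OPT-MD2CNF-attained Φ
... | α , α-optimal = cut , cut-covers , (begin
  length cut                          ≡⟨ length-cut ⟩
  n * 9 + (m + unsatisfied Φ α)       ≡⟨ cong (λ k → n * 9 + (k + unsatisfied Φ α)) (clauses≡2*variables Φ occ) ⟩
  n * 9 + (n * 2 + unsatisfied Φ α)   ≡⟨ +-assoc (n * 9) (n * 2) _ ⟨
  n * 9 + n * 2 + unsatisfied Φ α     ≡⟨ cong (_+ unsatisfied Φ α) (trans (*-comm 11 n) (*-distribˡ-+ n 9 2)) ⟨
  11 * n + unsatisfied Φ α            ≤⟨ +-monoʳ-≤ (11 * n) α-optimal ⟩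
  11 * n + OPT-MD2CNF Φ               ∎)
  where
  open AssignmentClustering Φ cr adm α
  open ≤-Reasoning
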